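{- Let $\mathbb{K}$ be a skew field. For every $\mathbf{A}\in\mathbb{K}^{m\times n\times p}$, $\text{BM-rank}(\mathbf{A})\le\min(m,n,p)$.
   Context: For conformable third order hypermatrices $\mathbf{A}^{(0)}\in\mathbb{K}^{n_0\times \ell\times n_2}$, $\mathbf{A}^{(1)}\in\mathbb{K}^{n_0\times n_1\times \ell}$, $\mathbf{A}^{(2)}\in\mathbb{K}^{\ell\times n_1\times n_2}$ (indices starting at $0$), the Bhattacharya-Mesner (BM) product $\mathrm{Prod}(\mathbf{A}^{(0)},\mathbf{A}^{(1)},\mathbf{A}^{(2)})\in\mathbb{K}^{n_0\times n_1\times n_2}$ has entries $\mathrm{Prod}(\mathbf{A}^{(0)},\mathbf{A}^{(1)},\mathbf{A}^{(2)})[i_0,i_1,i_2]=\sum_{0\le j<\ell}\mathbf{A}^{(0)}[i_0,j,i_2]\,\mathbf{A}^{(1)}[i_0,i_1,j]\,\mathbf{A}^{(2)}[j,i_1,i_2]$. The BM-rank of $\mathbf{A}\in\mathbb{K}^{n_0\times n_1\times n_2}$ is the least $r\ge 0$ such that $\mathbf{A}=\mathrm{Prod}(\mathbf{X}^{(0)},\mathbf{X}^{(1)},\mathbf{X}^{(2)})$ for some $\mathbf{X}^{(0)}\in\mathbb{K}^{n_0\times r\times n_2}$, $\mathbf{X}^{(1)}\in\mathbb{K}^{n_0\times n_1\times r}$, $\mathbf{X}^{(2)}\in\mathbb{K}^{r\times n_1\times n_2}$; equivalently, the least number of BM outer products (products with contracted dimension $1$) summing to $\mathbf{A}$. -}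

module Defs where

open import Level using (Level; _⊔_)
open import Data.Nat using (ℕ; zero; suc)
open import Data.Fin using (Fin)
open import Data.Product using (Σ; _×_)
open import Relation.Nullary using (¬_)
open import Algebra.Bundles using (Ring)
import Algebra.Definitions as AD

record DivisionRing (c ℓ : Level) : Set (Level.suc (c ⊔ ℓ)) where
  field
    ring : Ring c ℓ
  open Ring ring public
  field
    0#≉1#    : ¬ (0# ≈ 1#)
    inverse  : ∀ x → ¬ (x ≈ 0#) → AD.Invertible _≈_ 1# _*_ x

module _ {c ℓ : Level} (K : DivisionRing c ℓ) where
  open DivisionRing K using (Carrier; _≈_; _+_; _*_; 0#)

  sumFin : (l : ℕ) → (Fin l → Carrier) → Carrier
  sumFin zero    f = 0#
  sumFin (suc l) f = f Fin.zero + sumFin l (λ j → f (Fin.suc j))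

  HM : ℕ → ℕ → ℕ → Set c
  HM n0 n1 n2 = Fin n0 → Fin n1 → Fin n2 → Carrier

  Prod : {n0 n1 n2 l : ℕ} → HM n0 l n2 → HM n0 n1 l → HM l n1 n2 → HM n0 n1 n2
  Prod {l = l} A0 A1 A2 i0 i1 i2 =
    sumFin l (λ j → (A0 i0 j i2 * A1 i0 i1 j) * A2 j i1 i2)

  HasBMDecomp : {n0 n1 n2 : ℕ} → HM n0 n1 n2 → ℕ → Set (c ⊔ ℓ)
  HasBMDecomp {n0} {n1} {n2} A r =
    Σ (HM n0 r n2) λ X0 → Σ (HM n0 n1 r) λ X1 → Σ (HM r n1 n2) λ X2 →
      ∀ i0 i1 i2 → Prod X0 X1 X2 i0 i1 i2 ≈ A i0 i1 i2

-- A hypermatrix is its own BM product with Kronecker deltas and constant-one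
-- factors, contracting along any one of its three modes: for instance
-- A = Prod (δ i₀ j) 1 A with contracted dimension m, since the sum over j
-- keeps only j = i₀. Hence the BM-rank is at most each of m, n, p, and the
-- minimum of the three is one of them.
module Submission where

open import Defs
open import Level using (Level)
open import Data.Nat using (ℕ; _≤_; _⊓_; zero; suc)
open import Data.Nat.Properties using (⊓-sel; ≤-refl)
open import Data.Fin using (Fin; _≟_)
open import Data.Fin.Properties using (suc-injective)
open import Data.Product using (Σ; _×_; _,_)
open import Data.Sum using (inj₁; inj₂)
open import Relation.Nullary using (yes; no)
open import Data.Empty using (⊥-elim)
open import Relation.Binary.PropositionalEquality using (_≢_; subst; ≢-sym)
import Relation.Binary.PropositionalEquality as ≡

⊓-closed : {a : Level} (P : ℕ → Set a) {m n : ℕ} → P m → P n → P (m ⊓ n)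
⊓-closed P {m} {n} pm pn with ⊓-sel m n
... | inj₁ m⊓n≡m = subst P (≡.sym m⊓n≡m) pm
... | inj₂ m⊓n≡n = subst P (≡.sym m⊓n≡n) pn

module _ {c ℓ : Level} (K : DivisionRing c ℓ) where
  open DivisionRing K
  open import Relation.Binary.Reasoning.Setoid setoid

  sumFin-zero : (l : ℕ) (f : Fin l → Carrier) → (∀ j → f j ≈ 0#) → sumFin K l f ≈ 0#
  sumFin-zero zero    f f≈0 = refl
  sumFin-zero (suc l) f f≈0 = begin
    f Fin.zero + sumFin K l (λ j → f (Fin.suc j)) ≈⟨ +-cong (f≈0 Fin.zero) (sumFin-zero l _ (λ j → f≈0 (Fin.suc j))) ⟩
    0# + 0#                                         ≈⟨ +-identityˡ 0# ⟩
    0#                                              ∎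

  sumFin-supported : (l : ℕ) (f : Fin l → Carrier) (k : Fin l) →
                     (∀ j → j ≢ k → f j ≈ 0#) → sumFin K l f ≈ f k
  sumFin-supported (suc l) f Fin.zero f≈0 = begin
    f Fin.zero + sumFin K l (λ j → f (Fin.suc j)) ≈⟨ +-congˡ (sumFin-zero l _ (λ j → f≈0 (Fin.suc j) (λ ()))) ⟩
    f Fin.zero + 0#                                 ≈⟨ +-identityʳ _ ⟩
    f Fin.zero                                      ∎
  sumFin-supported (suc l) f (Fin.suc k) f≈0 = begin
    f Fin.zero + sumFin K l (λ j → f (Fin.suc j)) ≈⟨ +-cong (f≈0 Fin.zero (λ ())) (sumFin-supported l _ k f'≈0) ⟩
    0# + f (Fin.suc k)                              ≈⟨ +-identityˡ _ ⟩
    f (Fin.suc k)                                   ∎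
    where
    f'≈0 : ∀ j → j ≢ k → f (Fin.suc j) ≈ 0#
    f'≈0 j j≢k = f≈0 (Fin.suc j) (λ sj≡sk → j≢k (suc-injective sj≡sk))

  δ : {l : ℕ} → Fin l → Fin l → Carrier
  δ a b with a ≟ b
  ... | yes _ = 1#
  ... | no  _ = 0#

  δ-refl : {l : ℕ} (a : Fin l) → δ a a ≈ 1#
  δ-refl a with a ≟ a
  ... | yes _   = refl
  ... | no  a≢a = ⊥-elim (a≢a ≡.refl)

  δ-≢ : {l : ℕ} {a b : Fin l} → a ≢ b → δ a b ≈ 0#
  δ-≢ {a = a} {b} a≢b with a ≟ b
  ... | yes a≡b = ⊥-elim (a≢b a≡b)
  ... | no  _   = refl

  sumFin-δ : (l : ℕ) (k : Fin l) (f : Carrier → Fin l → Carrier) →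
             (∀ {x y} j → x ≈ y → f x j ≈ f y j) → (∀ j → f 0# j ≈ 0#) →
             sumFin K l (λ j → f (δ k j) j) ≈ f 1# k
  sumFin-δ l k f f-cong f0≈0 = begin
    sumFin K l (λ j → f (δ k j) j) ≈⟨ sumFin-supported l _ k (λ j j≢k → trans (f-cong j (δ-≢ (≢-sym j≢k))) (f0≈0 j)) ⟩
    f (δ k k) k                     ≈⟨ f-cong k (δ-refl k) ⟩
    f 1# k                          ∎

  module _ {n₀ n₁ n₂ : ℕ} (A : HM K n₀ n₁ n₂) where

    hasBMDecomp-n₀ : HasBMDecomp K A n₀
    hasBMDecomp-n₀ = (λ i₀ j i₂ → δ i₀ j) , (λ _ _ _ → 1#) , A , λ i₀ i₁ i₂ → begin
      sumFin K n₀ (λ j → (δ i₀ j * 1#) * A j i₁ i₂)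
        ≈⟨ sumFin-δ n₀ i₀ (λ x j → (x * 1#) * A j i₁ i₂) (λ _ x≈y → *-congʳ (*-congʳ x≈y))
                    (λ j → trans (*-congʳ (zeroˡ 1#)) (zeroˡ _)) ⟩
      (1# * 1#) * A i₀ i₁ i₂ ≈⟨ *-congʳ (*-identityˡ 1#) ⟩
      1# * A i₀ i₁ i₂        ≈⟨ *-identityˡ _ ⟩
      A i₀ i₁ i₂             ∎

    hasBMDecomp-n₁ : HasBMDecomp K A n₁
    hasBMDecomp-n₁ = A , (λ i₀ i₁ j → δ i₁ j) , (λ _ _ _ → 1#) , λ i₀ i₁ i₂ → begin
      sumFin K n₁ (λ j → (A i₀ j i₂ * δ i₁ j) * 1#)
        ≈⟨ sumFin-δ n₁ i₁ (λ x j → (A i₀ j i₂ * x) * 1#) (λ _ x≈y → *-congʳ (*-congˡ x≈y))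
                    (λ j → trans (*-congʳ (zeroʳ _)) (zeroˡ 1#)) ⟩
      (A i₀ i₁ i₂ * 1#) * 1# ≈⟨ *-identityʳ _ ⟩
      A i₀ i₁ i₂ * 1#        ≈⟨ *-identityʳ _ ⟩
      A i₀ i₁ i₂             ∎

    hasBMDecomp-n₂ : HasBMDecomp K A n₂
    hasBMDecomp-n₂ = (λ i₀ j i₂ → δ i₂ j) , A , (λ _ _ _ → 1#) , λ i₀ i₁ i₂ → begin
      sumFin K n₂ (λ j → (δ i₂ j * A i₀ i₁ j) * 1#)
        ≈⟨ sumFin-δ n₂ i₂ (λ x j → (x * A i₀ i₁ j) * 1#) (λ _ x≈y → *-congʳ (*-congʳ x≈y))
                    (λ j → trans (*-congʳ (zeroˡ _)) (zeroˡ 1#)) ⟩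
      (1# * A i₀ i₁ i₂) * 1# ≈⟨ *-identityʳ _ ⟩
      1# * A i₀ i₁ i₂        ≈⟨ *-identityˡ _ ⟩
      A i₀ i₁ i₂             ∎

proposition2 : {c ℓ : Level} (K : DivisionRing c ℓ) (m n p : ℕ) (A : HM K m n p) →
    Σ ℕ (λ r → (r ≤ m ⊓ (n ⊓ p)) × HasBMDecomp K A r)
proposition2 K m n p A =
  m ⊓ (n ⊓ p) , ≤-refl ,
  ⊓-closed (HasBMDecomp K A) (hasBMDecomp-n₀ K A)
    (⊓-closed (HasBMDecomp K A) (hasBMDecomp-n₁ K A) (hasBMDecomp-n₂ K A))
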